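{- Let $k$ be a positive integer, $n=4k^2$, and let $X,Y\subseteq[n]$ be ample sets (with respect to $\pi_n$). If $(\pi_n)_X=(\pi_n)_Y$, then $X=Y$.
   Context: Given a sequence of distinct elements of a totally ordered set, its pattern is the unique permutation $\tau$ of $[m]$ ($m$ the length) such that $t_i<t_j \iff \tau(i)<\tau(j)$. For a permutation $\sigma$ of $[n]$ and nonempty $X\subseteq[n]$, $\sigma_X$ is the pattern of the subsequence of $\sigma$ with indices in $X$. Let $\pi_n$ be the permutation of $[n]$ given by $\pi_n(2k(j-1)+i)=2ki-j+1$ for $i,j\in\{1,\dots,2k\}$ (in one-line notation $\pi_n=s\,(s-1)\cdots(s-2k+1)$ with $s=2k,4k,\dots,4k^2$). Identify index $2k(j-1)+i$ with the cell in column $j$, row $i$ of a $2k\times2k$ grid. With $C_1=R_1=\{1,\dots,k\}$ and $C_2=R_2=\{k+1,\dots,2k\}$, a set $X\subseteq[n]$ is ample if for every $a,b\in\{1,2\}$, every row in $R_b$ contains a cell of $X$ in some column of $C_a$, and every column in $C_a$ contains a cell of $X$ in some row of $R_b$ (i.e. each of the four $k\times k$ corner submatrices of the 0-1 matrix of $X$ has no zero row or column). -}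

module Defs where

open import Data.Nat using (ℕ; zero; suc; _+_; _*_; _∸_; _<_; NonZero)
open import Data.Nat.Properties using (_<?_)
open import Data.Nat.DivMod using (_/_; _%_)
open import Data.Fin using (Fin; toℕ)
open import Data.Fin.Subset using (Subset; _∈_)
open import Data.Fin.Subset.Properties using (_∈?_)
open import Data.List using (List; map; filter; length; allFin)
open import Data.Product using (Σ; _×_; ∃)
open import Relation.Binary.PropositionalEquality using (_≡_)

-- Positions are 0-based: position p : Fin n corresponds to index p+1 ∈ [n].
-- A permutation / sequence is given by its values.

-- The pattern of a sequence of distinct naturals t₁ … t_m:
-- τ(i) = 1 + #{ j : t_j < t_i }  (the unique permutation of [m] order-isomorphic to t).
pattern-of : List ℕ → List ℕ
pattern-of t = map (λ x → suc (length (filter (_<? x) t))) t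

subseq : ∀ {n} → (Fin n → ℕ) → Subset n → List ℕ
subseq {n} σ X = map σ (filter (λ i → i ∈? X) (allFin n))

restrictPattern : ∀ {n} → (Fin n → ℕ) → Subset n → List ℕ
restrictPattern σ X = pattern-of (subseq σ X)

size : ℕ → ℕ
size k = 4 * (k * k)

-- π_n(2k(j-1)+i) = 2ki - j + 1 for i, j ∈ {1..2k}.
-- With 0-based position p = 2k(j-1)+(i-1): i-1 = p mod 2k, j-1 = p div 2k.
-- Value = 2k·(p mod 2k + 1) - (p div 2k).  (k ≥ 1 needed for NonZero 2k.)
πval : (k : ℕ) → .{{NonZero k}} → ℕ → ℕ
πval (suc k') p = let m = 2 * suc k' in m * (p % m + 1) ∸ (p / m)

π : (k : ℕ) → .{{NonZero k}} → Fin (size k) → ℕ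
π k p = πval k (toℕ p)

-- Cell in column c, row r (both 0-based, < 2k) has 0-based position 2k·c + r.
-- Blocks: C₁ = R₁ = {0..k-1} (a = 0), C₂ = R₂ = {k..2k-1} (a = 1).
InCell : (k : ℕ) → Subset (size k) → ℕ → ℕ → Set
InCell k X c r = Σ (Fin (size k)) λ p → (toℕ p ≡ (2 * k) * c + r) × (p ∈ X)

-- X is ample: for all blocks a, b ∈ {0,1} (i.e. C_{a+1}, R_{b+1}),
--  every row in R_b has a cell of X in some column of C_a, and
--  every column in C_a has a cell of X in some row of R_b.
Ample : (k : ℕ) → Subset (size k) → Set
Ample k X =
  (a b : Fin 2) →
    ((r : ℕ) → r < k → ∃ λ c → c < k × InCell k X (toℕ a * k + c) (toℕ b * k + r))
  × ((c : ℕ) → c < k → ∃ λ r → r < k × InCell k X (toℕ a * k + c) (toℕ b * k + r))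

module Submission where

-- Equal patterns match the i-th element of X with the i-th element of Y, and this matching
-- preserves both the position order and the value order of π.  In π the cells are ordered
-- by (column, row) in position and by (row, reversed column) in value, so a descent strictly
-- increases the column while an ascent never decreases it; dually an ascent strictly
-- increases the row while a step back to an earlier cell of larger value never decreases it.
-- Ampleness lets every cell of X in column c be reached inside X by a walk of ascents and
-- exactly c descents (alternating between the low and the high rows), and likewise for rows.
-- Such walks transport along the matching, where the number of strict steps bounds the
-- column (row) of the endpoint; so the partner of x lies weakly beyond x in both coordinates,
-- and by symmetry in the same cell.

open import Data.Empty using (⊥-elim-irr)
open import Data.Fin using (Fin; toℕ; #_)
open import Data.Fin.Properties using (toℕ<n; toℕ-injective)
open import Data.Fin.Subset using (Subset; _∈_; _⊆_)
open import Data.Fin.Subset.Properties using (_∈?_; ⊆-antisym)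
open import Data.List using (List; []; _∷_; map; filter; length; allFin)
open import Data.List.Properties using (length-map)
open import Data.List.Membership.Propositional using () renaming (_∈_ to _∈ₗ_)
open import Data.List.Membership.Propositional.Properties using (∈-filter⁺; ∈-filter⁻; ∈-allFin)
open import Data.List.Relation.Unary.Any using (here; there)
open import Data.List.Relation.Unary.AllPairs using (AllPairs; _∷_)
import Data.List.Relation.Unary.All as All
import Data.List.Relation.Unary.AllPairs.Properties as AllPairs
open import Data.Nat using (ℕ; zero; suc; _+_; _*_; _∸_; _<_; _≤_; z≤n; s≤s; _<?_; NonZero)
open import Data.Nat.Properties
open import Data.Nat.DivMod using (_/_; _%_; m≡m%n+[m/n]*n; m%n<n; m<n*o⇒m/o<n)
open import Data.Nat.Tactic.RingSolver using (solve-∀)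
open import Data.Product using (∃; ∃-syntax; _×_; _,_; proj₁; proj₂; map₂)
open import Data.Product.Relation.Binary.Lex.Strict using (×-Lex)
open import Data.Sum using (inj₁; inj₂)
open import Function using (id; flip)
open import Relation.Binary.Definitions using (tri<; tri≈; tri>)
open import Relation.Binary.PropositionalEquality
open import Relation.Nullary using (¬_; yes; no; contradiction)
open import Relation.Unary using (Decidable)

open import Defs

data _[_]=_ {A : Set} : List A → ℕ → A → Set where
  here  : ∀ {x xs} → (x ∷ xs) [ 0 ]= x
  there : ∀ {x xs i y} → xs [ i ]= y → (x ∷ xs) [ suc i ]= y

module _ {A : Set} where

  private variable
    xs : List A
    x y : A
    i j : ℕ

  []=-functional : xs [ i ]= x → xs [ i ]= y → x ≡ y
  []=-functional here      here      = refl
  []=-functional (there p) (there q) = []=-functional p q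

  []=-map : ∀ {B : Set} (f : A → B) → xs [ i ]= x → map f xs [ i ]= f x
  []=-map f here      = here
  []=-map f (there p) = there ([]=-map f p)

  []=⇒<length : xs [ i ]= x → i < length xs
  []=⇒<length here      = s≤s z≤n
  []=⇒<length (there p) = s≤s ([]=⇒<length p)

  <length⇒[]= : ∀ {xs : List A} {i} → i < length xs → ∃ (xs [ i ]=_)
  <length⇒[]= {x ∷ _} {zero}  _         = x , here
  <length⇒[]= {_ ∷ _} {suc _} (s≤s i<n) = map₂ there (<length⇒[]= i<n)

  []=⇒∈ : xs [ i ]= x → x ∈ₗ xs
  []=⇒∈ here      = here refl
  []=⇒∈ (there p) = there ([]=⇒∈ p)

  ∈⇒[]= : x ∈ₗ xs → ∃[ i ] xs [ i ]= x
  ∈⇒[]= (here refl) = 0 , here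
  ∈⇒[]= (there p)   = let i , q = ∈⇒[]= p in suc i , there q

  AllPairs-[]= : ∀ {R : A → A → Set} →
                 AllPairs R xs → xs [ i ]= x → xs [ j ]= y → i < j → R x y
  AllPairs-[]= (Rx ∷ _)  here      (there q) _         = All.lookup Rx ([]=⇒∈ q)
  AllPairs-[]= (_ ∷ Rxs) (there p) (there q) (s≤s i<j) = AllPairs-[]= Rxs p q i<j

  key-<⇒index-< : ∀ (f : A → ℕ) → AllPairs (λ a b → f a < f b) xs →
                  xs [ i ]= x → xs [ j ]= y → f x < f y → i < j
  key-<⇒index-< {i = i} {j = j} f sorted p q fx<fy with <-cmp i j
  ... | tri< i<j _ _ = i<j
  ... | tri≈ _ refl _ = contradiction fx<fy (<-irrefl (cong f ([]=-functional p q)))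
  ... | tri> _ _ j<i = contradiction (AllPairs-[]= sorted q p j<i) (<-asym fx<fy)

module _ {A : Set} {P Q : A → Set} (P? : Decidable P) (Q? : Decidable Q) (P⇒Q : ∀ {x} → P x → Q x) where

  length-filter-mono : ∀ xs → length (filter P? xs) ≤ length (filter Q? xs)
  length-filter-mono [] = z≤n
  length-filter-mono (x ∷ xs) with P? x | Q? x
  ... | yes _  | yes _  = s≤s (length-filter-mono xs)
  ... | yes px | no ¬qx = contradiction (P⇒Q px) ¬qx
  ... | no _   | yes _  = m≤n⇒m≤1+n (length-filter-mono xs)
  ... | no _   | no _   = length-filter-mono xs

  length-filter-mono-strict : ∀ {xs : List A} {i x} → xs [ i ]= x → ¬ P x → Q x →
                              length (filter P? xs) < length (filter Q? xs)
  length-filter-mono-strict {x ∷ xs} here ¬px qx with P? x | Q? x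
  ... | yes px | _      = contradiction px ¬px
  ... | no _   | yes _  = s≤s (length-filter-mono xs)
  ... | no _   | no ¬qx = contradiction qx ¬qx
  length-filter-mono-strict {y ∷ xs} (there p) ¬px qx with P? y | Q? y
  ... | yes _  | yes _  = s≤s (length-filter-mono-strict p ¬px qx)
  ... | yes py | no ¬qy = contradiction (P⇒Q py) ¬qy
  ... | no _   | yes _  = m≤n⇒m≤1+n (length-filter-mono-strict p ¬px qx)
  ... | no _   | no _   = length-filter-mono-strict p ¬px qx

countBelow : ℕ → List ℕ → ℕ
countBelow v t = length (filter (_<? v) t)

pattern-of-[]= : ∀ {s t i v w} → pattern-of s ≡ pattern-of t →
                 s [ i ]= v → t [ i ]= w → countBelow v s ≡ countBelow w t
pattern-of-[]= {s} {t} same sv tw = suc-injective ([]=-functional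
  (subst (_[ _ ]= _) same ([]=-map (λ x → suc (countBelow x s)) sv))
  ([]=-map (λ x → suc (countBelow x t)) tw))

pattern-of-preserves-< : ∀ {s t i j v v′ w w′} → pattern-of s ≡ pattern-of t →
                         s [ i ]= v → s [ j ]= v′ → t [ i ]= w → t [ j ]= w′ → v < v′ → w < w′
pattern-of-preserves-< {s} {t} {v = v} {v′} {w} {w′} same sv sv′ tw tw′ v<v′ =
  ≰⇒> λ w′≤w → n≮n (countBelow w t) (begin-strict
    countBelow w t   ≡⟨ sym (pattern-of-[]= same sv tw) ⟩
    countBelow v s   <⟨ length-filter-mono-strict (_<? v) (_<? v′) (λ x<v → <-trans x<v v<v′)
                          sv (n≮n v) v<v′ ⟩
    countBelow v′ s  ≡⟨ pattern-of-[]= same sv′ tw′ ⟩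
    countBelow w′ t  ≤⟨ length-filter-mono (_<? w′) (_<? w) (λ x<w′ → <-≤-trans x<w′ w′≤w) t ⟩
    countBelow w t   ∎)
  where open ≤-Reasoning

data Walk {A : Set} (N : A → Set) (F C : A → A → Set) : ℕ → A → Set where
  start : ∀ {x} → N x → Walk N F C 0 x
  free  : ∀ {t y x} → Walk N F C t y → F y x → N x → Walk N F C t x
  step  : ∀ {t y x} → Walk N F C t y → C y x → N x → Walk N F C (suc t) x

Transports : {A : Set} → (A → A → Set) → (A → A → Set) → Set
Transports R F = ∀ {x′ x y′ y} → R x′ y′ → R x y → F x′ x → F y′ y

module _ {A : Set} {N : A → Set} {F C : A → A → Set} where

  walk-end : ∀ {t x} → Walk N F C t x → N x
  walk-end (start Nx)    = Nx
  walk-end (free _ _ Nx) = Nx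
  walk-end (step _ _ Nx) = Nx

  walk-length-≤ : (h : A → ℕ) → (∀ {y x} → F y x → h y ≤ h x) → (∀ {y x} → C y x → h y < h x) →
                  ∀ {t x} → Walk N F C t x → t ≤ h x
  walk-length-≤ h F-mono C-mono (start _)    = z≤n
  walk-length-≤ h F-mono C-mono (free w f _) = ≤-trans (walk-length-≤ h F-mono C-mono w) (F-mono f)
  walk-length-≤ h F-mono C-mono (step w c _) = <-≤-trans (s≤s (walk-length-≤ h F-mono C-mono w)) (C-mono c)

  walk-transport : ∀ {N′ : A → Set} (R : A → A → Set) →
                   (∀ {x} → N x → ∃ (R x)) → (∀ {x y} → R x y → N′ y) →
                   Transports R F → Transports R C →
                   ∀ {t x y} → Walk N F C t x → R x y → Walk N′ F C t y
  walk-transport R total target RF RC = go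
    where
    go : ∀ {t x y} → Walk N F C t x → R x y → Walk _ F C t y
    go (start _)    xy = start (target xy)
    go (free w f _) xy = let _ , x′y′ = total (walk-end w) in free (go w x′y′) (RF x′y′ xy f) (target xy)
    go (step w c _) xy = let _ , x′y′ = total (walk-end w) in step (go w x′y′) (RC x′y′ xy c) (target xy)

module _ {n : ℕ} where

  members : Subset n → List (Fin n)
  members X = filter (_∈? X) (allFin n)

  members-increasing : ∀ X → AllPairs (λ a b → toℕ a < toℕ b) (members X)
  members-increasing X = AllPairs.filter⁺ (_∈? X) (AllPairs.tabulate⁺-< id)

  ∈⇒members : ∀ {X x} → x ∈ X → ∃[ i ] members X [ i ]= x
  ∈⇒members {X} {x} x∈X = ∈⇒[]= (∈-filter⁺ (_∈? X) (∈-allFin x) x∈X)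

  members⇒∈ : ∀ {X i x} → members X [ i ]= x → x ∈ X
  members⇒∈ {X} p = proj₂ (∈-filter⁻ (_∈? X) {xs = allFin n} ([]=⇒∈ p))

  length-restrictPattern : ∀ (σ : Fin n → ℕ) X → length (restrictPattern σ X) ≡ length (members X)
  length-restrictPattern σ X = trans (length-map _ (map σ (members X))) (length-map σ (members X))

  data Corresponds (X Y : Subset n) (x y : Fin n) : Set where
    same-index : ∀ {i} → members X [ i ]= x → members Y [ i ]= y → Corresponds X Y x y

  corresponds-sym : ∀ {X Y x y} → Corresponds X Y x y → Corresponds Y X y x
  corresponds-sym (same-index x y) = same-index y x

  corresponds-∈ˡ : ∀ {X Y x y} → Corresponds X Y x y → x ∈ X
  corresponds-∈ˡ (same-index x _) = members⇒∈ x

  corresponds-∈ʳ : ∀ {X Y x y} → Corresponds X Y x y → y ∈ Y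
  corresponds-∈ʳ (same-index _ y) = members⇒∈ y

  corresponds-preserves-position : ∀ {X Y} → Transports (Corresponds X Y) (λ x′ x → toℕ x′ < toℕ x)
  corresponds-preserves-position {X} {Y} (same-index x′ y′) (same-index x y) x′<x =
    AllPairs-[]= (members-increasing Y) y′ y (key-<⇒index-< toℕ (members-increasing X) x′ x x′<x)

  Ascent Descent : (Fin n → ℕ) → Fin n → Fin n → Set
  Ascent  σ y x = toℕ y < toℕ x × σ y < σ x
  Descent σ y x = toℕ y < toℕ x × σ x < σ y

  module _ (σ : Fin n → ℕ) {X Y : Subset n} (same : restrictPattern σ X ≡ restrictPattern σ Y) where

    corresponds-total : ∀ {x} → x ∈ X → ∃ (Corresponds X Y x)
    corresponds-total x∈X =
      let i , x = ∈⇒members x∈X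
          y , y∈ = <length⇒[]= (subst (i <_) length-members-≡ ([]=⇒<length x))
      in y , same-index x y∈
      where
      length-members-≡ : length (members X) ≡ length (members Y)
      length-members-≡ = trans (sym (length-restrictPattern σ X))
                               (trans (cong length same) (length-restrictPattern σ Y))

    corresponds-preserves-value : Transports (Corresponds X Y) (λ x′ x → σ x′ < σ x)
    corresponds-preserves-value (same-index x′ y′) (same-index x y) =
      pattern-of-preserves-< same ([]=-map σ x′) ([]=-map σ x) ([]=-map σ y′) ([]=-map σ y)

    corresponds-preserves-ascent : Transports (Corresponds X Y) (Ascent σ)
    corresponds-preserves-ascent x′y′ xy (pos , val) =
      corresponds-preserves-position x′y′ xy pos , corresponds-preserves-value x′y′ xy val

    corresponds-preserves-descent : Transports (Corresponds X Y) (Descent σ)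
    corresponds-preserves-descent x′y′ xy (pos , val) =
      corresponds-preserves-position x′y′ xy pos , corresponds-preserves-value xy x′y′ val

    corresponds-preserves-flip-descent : Transports (Corresponds X Y) (flip (Descent σ))
    corresponds-preserves-flip-descent x′y′ xy = corresponds-preserves-descent xy x′y′

_<ₗₑₓ_ : ℕ × ℕ → ℕ × ℕ → Set
_<ₗₑₓ_ = ×-Lex _≡_ _<_ _<_

module _ (M : ℕ) where

  lex-encode-< : ∀ {a b a′ b′} → b < M → (a , b) <ₗₑₓ (a′ , b′) → M * a + b < M * a′ + b′
  lex-encode-< {a} {b} {a′} {b′} b<M (inj₁ a<a′) = begin-strict
    M * a + b    <⟨ +-monoʳ-< (M * a) b<M ⟩
    M * a + M    ≡⟨ +-comm (M * a) M ⟩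
    M + M * a    ≡⟨ sym (*-suc M a) ⟩
    M * suc a    ≤⟨ *-monoʳ-≤ M a<a′ ⟩
    M * a′       ≤⟨ m≤m+n (M * a′) b′ ⟩
    M * a′ + b′  ∎
    where open ≤-Reasoning
  lex-encode-< {a} _ (inj₂ (refl , b<b′)) = +-monoʳ-< (M * a) b<b′

  lex-decode-< : ∀ {a b a′ b′} → b < M → b′ < M →
                 M * a + b < M * a′ + b′ → (a , b) <ₗₑₓ (a′ , b′)
  lex-decode-< {a} {b} {a′} {b′} b<M b′<M lt with <-cmp a a′
  ... | tri< a<a′ _ _ = inj₁ a<a′
  ... | tri≈ _ refl _ = inj₂ (refl , +-cancelˡ-< (M * a) b b′ lt)
  ... | tri> _ _ a>a′ = contradiction lt (<-asym (lex-encode-< b′<M (inj₁ a>a′)))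

  lex-encode-injective : ∀ {a b a′ b′} → b < M → b′ < M →
                         M * a + b ≡ M * a′ + b′ → a ≡ a′ × b ≡ b′
  lex-encode-injective {a} {b} {a′} {b′} b<M b′<M eq with <-cmp a a′
  ... | tri< a<a′ _ _ = contradiction eq (<⇒≢ (lex-encode-< b<M (inj₁ a<a′)))
  ... | tri≈ _ refl _ = refl , +-cancelˡ-≡ (M * a) b b′ eq
  ... | tri> _ _ a>a′ = contradiction (sym eq) (<⇒≢ (lex-encode-< b′<M (inj₁ a>a′)))

m*[n+1]∸o≡1+m*n+[m∸1+o] : ∀ m n o → o < m → m * (n + 1) ∸ o ≡ suc (m * n + (m ∸ suc o))
m*[n+1]∸o≡1+m*n+[m∸1+o] (suc m) n o (s≤s o≤m) = begin
  suc m * (n + 1) ∸ o          ≡⟨ cong (_∸ o) (*-distribˡ-+ (suc m) n 1) ⟩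
  suc m * n + suc m * 1 ∸ o    ≡⟨ cong (λ z → suc m * n + z ∸ o) (*-identityʳ (suc m)) ⟩
  suc m * n + suc m ∸ o        ≡⟨ +-∸-assoc (suc m * n) (m≤n⇒m≤1+n o≤m) ⟩
  suc m * n + (suc m ∸ o)      ≡⟨ cong (suc m * n +_) (+-∸-assoc 1 o≤m) ⟩
  suc m * n + suc (m ∸ o)      ≡⟨ +-suc (suc m * n) (m ∸ o) ⟩
  suc (suc m * n + (m ∸ o))    ∎
  where open ≡-Reasoning

4*[n*n]≡[2*n]*[2*n] : ∀ n → 4 * (n * n) ≡ (2 * n) * (2 * n)
4*[n*n]≡[2*n]*[2*n] = solve-∀

module Grid (k-1 : ℕ) where

  k side : ℕ
  k = suc k-1
  side = 2 * k

  size≡side*side : size k ≡ side * side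
  size≡side*side = 4*[n*n]≡[2*n]*[2*n] k

  column row : Fin (size k) → ℕ
  column p = toℕ p / side
  row    p = toℕ p % side

  mirror : ℕ → ℕ
  mirror c = side ∸ suc c

  row<side : ∀ p → row p < side
  row<side p = m%n<n (toℕ p) side

  column<side : ∀ p → column p < side
  column<side p = m<n*o⇒m/o<n {n = side} (subst (toℕ p <_) size≡side*side (toℕ<n p))

  mirror<side : ∀ c → mirror c < side
  mirror<side c = s≤s (m∸n≤m _ c)

  toℕ≡cell : ∀ p → toℕ p ≡ side * column p + row p
  toℕ≡cell p = trans (m≡m%n+[m/n]*n (toℕ p) side)
                     (trans (+-comm (row p) _) (cong (_+ row p) (*-comm (column p) side)))

  π≡cell : ∀ p → π k p ≡ suc (side * row p + mirror (column p))
  π≡cell p = m*[n+1]∸o≡1+m*n+[m∸1+o] side (row p) (column p) (column<side p)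

  cell-injective : ∀ {p q} → column p ≡ column q → row p ≡ row q → p ≡ q
  cell-injective {p} {q} c≡ r≡ =
    toℕ-injective (trans (toℕ≡cell p)
                         (trans (cong₂ (λ c r → side * c + r) c≡ r≡) (sym (toℕ≡cell q))))

  cell-coordinates : ∀ {p c r} → toℕ p ≡ side * c + r → r < side → column p ≡ c × row p ≡ r
  cell-coordinates {p} eq r<side = lex-encode-injective side (row<side p) r<side (trans (sym (toℕ≡cell p)) eq)

  mirror-< : ∀ {c c′} → c < c′ → c′ < side → mirror c′ < mirror c
  mirror-< c<c′ c′<side = ∸-monoʳ-< {m = side} (s≤s c<c′) c′<side

  mirror-<⁻ : ∀ {c c′} → mirror c′ < mirror c → c < c′
  mirror-<⁻ {c} {c′} m< =
    ≰⇒> λ c′≤c → n≮n (mirror c′) (<-≤-trans m< (∸-monoʳ-≤ side (s≤s c′≤c)))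

  position-<⇒lex : ∀ {y x} → toℕ y < toℕ x → (column y , row y) <ₗₑₓ (column x , row x)
  position-<⇒lex {y} {x} y<x =
    lex-decode-< side (row<side y) (row<side x) (subst₂ _<_ (toℕ≡cell y) (toℕ≡cell x) y<x)

  lex⇒position-< : ∀ {y x} → (column y , row y) <ₗₑₓ (column x , row x) → toℕ y < toℕ x
  lex⇒position-< {y} {x} lex =
    subst₂ _<_ (sym (toℕ≡cell y)) (sym (toℕ≡cell x)) (lex-encode-< side (row<side y) lex)

  value-<⇒lex : ∀ {y x} → π k y < π k x → (row y , mirror (column y)) <ₗₑₓ (row x , mirror (column x))
  value-<⇒lex {y} {x} y<x with subst₂ _<_ (π≡cell y) (π≡cell x) y<x
  ... | s≤s lt = lex-decode-< side (mirror<side (column y)) (mirror<side (column x)) lt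

  lex⇒value-< : ∀ {y x} → (row y , mirror (column y)) <ₗₑₓ (row x , mirror (column x)) → π k y < π k x
  lex⇒value-< {y} {x} lex =
    subst₂ _<_ (sym (π≡cell y)) (sym (π≡cell x)) (s≤s (lex-encode-< side (mirror<side (column y)) lex))

  column-<⇒position-< : ∀ {y x} → column y < column x → toℕ y < toℕ x
  column-<⇒position-< {y} {x} c< = lex⇒position-< {y} {x} (inj₁ c<)

  row-<⇒position-< : ∀ {y x} → column y ≡ column x → row y < row x → toℕ y < toℕ x
  row-<⇒position-< {y} {x} c≡ r< = lex⇒position-< {y} {x} (inj₂ (c≡ , r<))

  row-<⇒value-< : ∀ {y x} → row y < row x → π k y < π k x
  row-<⇒value-< {y} {x} r< = lex⇒value-< {y} {x} (inj₁ r<)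

  column->⇒value-< : ∀ {y x} → row y ≡ row x → column x < column y → π k y < π k x
  column->⇒value-< {y} {x} r≡ c> = lex⇒value-< {y} {x} (inj₂ (r≡ , mirror-< c> (column<side y)))

  position-<⇒column-≤ : ∀ {y x} → toℕ y < toℕ x → column y ≤ column x
  position-<⇒column-≤ {y} {x} y<x with position-<⇒lex {y} {x} y<x
  ... | inj₁ c<       = <⇒≤ c<
  ... | inj₂ (c≡ , _) = ≤-reflexive c≡

  value-<⇒row-≤ : ∀ {y x} → π k y < π k x → row y ≤ row x
  value-<⇒row-≤ {y} {x} y<x with value-<⇒lex {y} {x} y<x
  ... | inj₁ r<       = <⇒≤ r<
  ... | inj₂ (r≡ , _) = ≤-reflexive r≡

  descent-column-< : ∀ {y x} → Descent (π k) y x → column y < column x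
  descent-column-< {y} {x} (y<x , x<y) with position-<⇒lex {y} {x} y<x | value-<⇒lex {x} {y} x<y
  ... | inj₁ c<        | _             = c<
  ... | inj₂ (_ , r<) | inj₁ r>        = contradiction r< (<-asym r>)
  ... | inj₂ (_ , r<) | inj₂ (r≡ , _) = contradiction (sym r≡) (<⇒≢ r<)

  ascent-row-< : ∀ {y x} → Ascent (π k) y x → row y < row x
  ascent-row-< {y} {x} (y<x , y<ᵥx) with value-<⇒lex {y} {x} y<ᵥx
  ... | inj₁ r<       = r<
  ... | inj₂ (_ , m<) = contradiction (position-<⇒column-≤ {y} {x} y<x) (<⇒≱ (mirror-<⁻ m<))

  InBlock : Fin 2 → ℕ → Set
  InBlock a x = ∃[ x′ ] x′ < k × x ≡ toℕ a * k + x′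

  inBlock-0⇒< : ∀ {x} → InBlock (# 0) x → x < k
  inBlock-0⇒< (_ , x′<k , refl) = x′<k

  inBlock-1⇒≥ : ∀ {x} → InBlock (# 1) x → k ≤ x
  inBlock-1⇒≥ (x′ , _ , refl) = ≤-trans (m≤m+n k 0) (m≤m+n (k + 0) x′)

  inBlock⇒<side : ∀ a {x} → InBlock a x → x < side
  inBlock⇒<side a (x′ , x′<k , refl) = begin-strict
    toℕ a * k + x′    <⟨ +-monoʳ-< (toℕ a * k) x′<k ⟩
    toℕ a * k + k     ≡⟨ +-comm (toℕ a * k) k ⟩
    suc (toℕ a) * k   ≤⟨ *-monoˡ-≤ k (toℕ<n a) ⟩
    side              ∎
    where open ≤-Reasoning

  <side⇒inBlock : ∀ {x} → x < side → ∃[ a ] InBlock a x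
  <side⇒inBlock {x} x<side with x <? k
  ... | yes x<k = # 0 , x , x<k , refl
  ... | no  x≮k = # 1 , x ∸ k , m<n+o⇒m∸n<o x k (subst (x <_) (cong (k +_) (+-identityʳ k)) x<side) ,
                  trans (sym (m+[n∸m]≡n (≮⇒≥ x≮k))) (cong (_+ (x ∸ k)) (sym (+-identityʳ k)))

  cell-of : ∀ {X c r} → InCell k X c r → r < side → ∃[ p ] p ∈ X × column p ≡ c × row p ≡ r
  cell-of (p , eq , p∈X) r<side = p , p∈X , cell-coordinates eq r<side

  ColumnWalk RowWalk : Subset (size k) → ℕ → Fin (size k) → Set
  ColumnWalk X = Walk (_∈ X) (Ascent (π k)) (Descent (π k))
  RowWalk    X = Walk (_∈ X) (flip (Descent (π k))) (Ascent (π k))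

  columnWalk-length-≤ : ∀ {X t x} → ColumnWalk X t x → t ≤ column x
  columnWalk-length-≤ =
    walk-length-≤ column (λ {y} {x} (y<x , _) → position-<⇒column-≤ {y} {x} y<x) descent-column-<

  rowWalk-length-≤ : ∀ {X t x} → RowWalk X t x → t ≤ row x
  rowWalk-length-≤ =
    walk-length-≤ row (λ {y} {x} (_ , y<x) → value-<⇒row-≤ {y} {x} y<x) ascent-row-<

  module _ {X : Subset (size k)} (ample : Ample k X) where

    column-meets-block : ∀ {c} → c < side → ∀ b → ∃[ p ] p ∈ X × column p ≡ c × InBlock b (row p)
    column-meets-block c<side b with <side⇒inBlock c<side
    ... | a , c′ , c′<k , refl =
      let r′ , r′<k , cell     = proj₂ (ample a b) c′ c′<k
          p , p∈X , col≡ , row≡ = cell-of cell (inBlock⇒<side b (r′ , r′<k , refl))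
      in p , p∈X , col≡ , r′ , r′<k , row≡

    row-meets-block : ∀ {r} → r < side → ∀ a → ∃[ p ] p ∈ X × row p ≡ r × InBlock a (column p)
    row-meets-block r<side a with <side⇒inBlock r<side
    ... | b , r′ , r′<k , refl =
      let c′ , c′<k , cell     = proj₁ (ample a b) r′ r′<k
          p , p∈X , col≡ , row≡ = cell-of cell (inBlock⇒<side b (r′ , r′<k , refl))
      in p , p∈X , row≡ , c′ , c′<k , col≡

    column-walk : ∀ c {x} → column x ≡ c → x ∈ X → ColumnWalk X c x
    column-walk-low-row : ∀ c {x} → column x ≡ suc c → row x < k → x ∈ X → ColumnWalk X (suc c) x

    column-walk zero        _   x∈X = start x∈X
    column-walk (suc c) {x} col x∈X with row x <? k
    ... | yes low = column-walk-low-row c col low x∈X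
    ... | no  ¬low =
      let q , q∈X , col-q , block-q = column-meets-block (subst (_< side) col (column<side x)) (# 0)
          row-q<row-x = <-≤-trans (inBlock-0⇒< block-q) (≮⇒≥ ¬low)
      in free (column-walk-low-row c col-q (inBlock-0⇒< block-q) q∈X)
              (row-<⇒position-< {q} {x} (trans col-q (sym col)) row-q<row-x ,
               row-<⇒value-< {q} {x} row-q<row-x)
              x∈X

    column-walk-low-row c {x} col low x∈X =
      let p , p∈X , col-p , block-p = column-meets-block c<side (# 1)
      in step (column-walk c col-p p∈X)
              (column-<⇒position-< {p} {x} (subst₂ _<_ (sym col-p) (sym col) (n<1+n c)) ,
               row-<⇒value-< {x} {p} (<-≤-trans low (inBlock-1⇒≥ block-p)))
              x∈X
      where
      c<side : c < side
      c<side = <-trans (n<1+n c) (subst (_< side) col (column<side x))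

    row-walk : ∀ r {x} → row x ≡ r → x ∈ X → RowWalk X r x
    row-walk-high-column : ∀ r {x} → row x ≡ suc r → k ≤ column x → x ∈ X → RowWalk X (suc r) x

    row-walk zero        _   x∈X = start x∈X
    row-walk (suc r) {x} rw x∈X with column x <? k
    ... | no  ¬low = row-walk-high-column r rw (≮⇒≥ ¬low) x∈X
    ... | yes low =
      let z , z∈X , row-z , block-z = row-meets-block (subst (_< side) rw (row<side x)) (# 1)
          col-x<col-z = <-≤-trans low (inBlock-1⇒≥ block-z)
      in free (row-walk-high-column r row-z (inBlock-1⇒≥ block-z) z∈X)
              (column-<⇒position-< {x} {z} col-x<col-z ,
               column->⇒value-< {z} {x} (trans row-z (sym rw)) col-x<col-z)
              x∈X

    row-walk-high-column r {x} rw high x∈X =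
      let w , w∈X , row-w , block-w = row-meets-block r<side (# 0)
      in step (row-walk r row-w w∈X)
              (column-<⇒position-< {w} {x} (<-≤-trans (inBlock-0⇒< block-w) high) ,
               row-<⇒value-< {w} {x} (subst₂ _<_ (sym row-w) (sym rw) (n<1+n r)))
              x∈X
      where
      r<side : r < side
      r<side = <-trans (n<1+n r) (subst (_< side) rw (row<side x))

  corresponding-cells-≤ : ∀ {X Y} → restrictPattern (π k) X ≡ restrictPattern (π k) Y → Ample k X →
                          ∀ {x y} → Corresponds X Y x y → column x ≤ column y × row x ≤ row y
  corresponding-cells-≤ {X} {Y} same ample {x} xy =
      columnWalk-length-≤ (transport (corresponds-preserves-ascent (π k) same)
                                     (corresponds-preserves-descent (π k) same)
                                     (column-walk ample (column x) refl x∈X) xy)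
    , rowWalk-length-≤ (transport (corresponds-preserves-flip-descent (π k) same)
                                  (corresponds-preserves-ascent (π k) same)
                                  (row-walk ample (row x) refl x∈X) xy)
    where
    x∈X : x ∈ X
    x∈X = corresponds-∈ˡ xy

    transport : ∀ {F C} → Transports (Corresponds X Y) F → Transports (Corresponds X Y) C →
                ∀ {t u v} → Walk (_∈ X) F C t u → Corresponds X Y u v → Walk (_∈ Y) F C t v
    transport = walk-transport (Corresponds X Y) (corresponds-total (π k) same) corresponds-∈ʳ

  ample-⊆ : ∀ {X Y} → Ample k X → Ample k Y →
            restrictPattern (π k) X ≡ restrictPattern (π k) Y → X ⊆ Y
  ample-⊆ {X} {Y} ampleX ampleY same x∈X =
    let _ , xy  = corresponds-total (π k) same x∈X
        c≤ , r≤ = corresponding-cells-≤ same ampleX xy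
        c≥ , r≥ = corresponding-cells-≤ (sym same) ampleY (corresponds-sym xy)
    in subst (_∈ Y) (sym (cell-injective (≤-antisym c≤ c≥) (≤-antisym r≤ r≥))) (corresponds-∈ʳ xy)

mainTheorem4 : (k : ℕ) → .{{_ : NonZero k}} → (X Y : Subset (size k)) →
    Ample k X → Ample k Y →
    restrictPattern (π k) X ≡ restrictPattern (π k) Y → X ≡ Y
mainTheorem4 zero {{k≢0}} _ _ _ _ _ = ⊥-elim-irr (NonZero.nonZero k≢0)
mainTheorem4 (suc k-1) X Y ampleX ampleY same =
  ⊆-antisym (ample-⊆ ampleX ampleY same) (ample-⊆ ampleY ampleX (sym same))
  where open Grid k-1
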